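{- Let $G$ be a finite graph whose maximal valency equals $d$. Then $\mathrm{Hom}(G,K_n)$ is connected for all $n\geq d+2$.
   Context: Graphs are finite and undirected ($E(G)\subseteq V(G)\times V(G)$ symmetric, loops allowed). The valency of a vertex is its number of neighbors. $K_n$ is the unlooped complete graph on $[n]$. For graphs $G,H$, $\mathrm{Hom}(G,H)$ is the polyhedral complex whose cells are indexed by functions $\eta:V(G)\to 2^{V(H)}\setminus\{\emptyset\}$ with $\eta(x)\times\eta(y)\subseteq E(H)$ whenever $(x,y)\in E(G)$; the cell $\eta$ is the product of the simplices with vertex sets $\eta(x)$, $x\in V(G)$, and its closure consists of the cells $\tilde\eta$ with $\tilde\eta(v)\subseteq\eta(v)$ for all $v$. Its vertices are the graph homomorphisms $G\to H$. -}

module Defs where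

open import Data.Nat using (ℕ; _≤_)
open import Data.Bool using (Bool; true; false; not)
open import Data.Fin using (Fin)
open import Data.Fin.Properties using (_≟_)
open import Data.Fin.Subset using (Subset; _∈_; _⊆_; ∣_∣; Nonempty)
open import Data.Vec using (tabulate)
open import Data.Product using (Σ; ∃; _×_; _,_; proj₁)
open import Relation.Nullary.Decidable using (⌊_⌋)
open import Relation.Binary.PropositionalEquality using (_≡_)
open import Relation.Binary.Construct.Closure.Equivalence using (EqClosure)

-- A finite undirected graph on vertex set Fin size; loops allowed.
record Graph : Set where
  field
    size : ℕ
    adj  : Fin size → Fin size → Bool
    adj-sym : ∀ x y → adj x y ≡ adj y x
open Graph public

-- neighbourhood of x (includes x itself iff x has a loop)
nbhd : (G : Graph) → Fin (size G) → Subset (size G)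
nbhd G x = tabulate (adj G x)

valency : (G : Graph) → Fin (size G) → ℕ
valency G x = ∣ nbhd G x ∣

MaxValency : Graph → ℕ → Set
MaxValency G d = (∃ λ x → valency G x ≡ d) × (∀ x → valency G x ≤ d)

K : ℕ → Graph
K n = record { size = n ; adj = λ i j → not ⌊ i ≟ j ⌋ ; adj-sym = λ i j → symm i j }
  where
  open import Relation.Nullary using (yes; no)
  open import Relation.Binary.PropositionalEquality using (refl; sym)
  symm : ∀ (i j : Fin n) → not ⌊ i ≟ j ⌋ ≡ not ⌊ j ≟ i ⌋
  symm i j with i ≟ j | j ≟ i
  ... | yes _ | yes _ = refl
  ... | no _  | no _  = refl
  ... | yes p | no q  with q (sym p)
  ... | ()
  symm i j | no p | yes q with p (sym q)
  ... | ()

-- cells of Hom(G,H): η : V(G) → nonempty subsets of V(H) with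
-- η(x) × η(y) ⊆ E(H) whenever (x,y) ∈ E(G)
IsCell : (G H : Graph) → (Fin (size G) → Subset (size H)) → Set
IsCell G H η =
  (∀ x → Nonempty (η x)) ×
  (∀ x y → adj G x y ≡ true →
     ∀ a b → a ∈ η x → b ∈ η y → adj H a b ≡ true)

Cell : Graph → Graph → Set
Cell G H = Σ (Fin (size G) → Subset (size H)) (IsCell G H)

-- face relation: τ lies in the closure of σ
_≼_ : ∀ {G H} → Cell G H → Cell G H → Set
τ ≼ σ = ∀ v → proj₁ τ v ⊆ proj₁ σ v

-- Hom(G,H) is connected: any two cells are joined by a zigzag of
-- face incidences (connectedness of the face poset of the complex)
HomConnected : Graph → Graph → Set
HomConnected G H = ∀ (σ τ : Cell G H) → EqClosure (_≼_ {G} {H}) σ τ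

{-# OPTIONS --safe #-}
-- The vertices of Hom(G, K n) are the proper n-colourings of G, and every cell
-- lies above one of them, so it suffices to connect any colouring f to any
-- other colouring g.  Recolouring a single vertex w to a colour unused on its
-- neighbourhood moves along an edge of the complex: the cell x ↦ {f x, f' x}
-- joins the two vertices.  With n ≥ d + 2 colours every vertex has a colour
-- free of both its at most d neighbours' colours and any one prescribed colour.
-- So f is turned into g vertex by vertex: to give w the colour g w, first
-- recolour every vertex that carries g w but disagrees with g (no vertex that
-- agrees with g and carries g w is adjacent to w); then recolour w itself.
module Submission where

open import Defs
open import Data.Nat using (ℕ; _≤_; _+_; zero; suc; z≤n; s≤s; _<_)
open import Data.Nat.Properties using (≤-trans; ≤-reflexive; n≤1+n; n<1+n; +-monoʳ-≤; +-suc; +-comm; module ≤-Reasoning)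
open import Data.Bool using (true)
open import Data.Fin using (Fin) renaming (zero to fzero; suc to fsuc)
open import Data.Fin.Properties using (_≟_)
open import Data.Fin.Subset using (Subset; _∈_; _∉_; ∣_∣; ⁅_⁆; _∪_; ⊥; inside; outside)
open import Data.Fin.Subset.Properties using (x∈⁅x⁆; x∈⁅y⁆⇒x≡y; x∈p∪q⁻; p⊆p∪q; q⊆p∪q; ∣⁅x⁆∣≡1; ∣⊥∣≡0; drop-there)
open import Data.Vec using ([]; _∷_; tabulate; here; there)
open import Data.Vec.Properties using (lookup∘tabulate; lookup⇒[]=)
open import Data.Vec.Functional using (updateAt)
open import Data.Vec.Functional.Properties using (updateAt-updates; updateAt-minimal)
open import Data.Product using (∃; _×_; _,_; proj₁; proj₂)
open import Data.Sum using (_⊎_; inj₁; inj₂)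
open import Function using (_∘_; const)
open import Relation.Nullary using (yes; no; contradiction)
open import Relation.Binary using (Rel; Reflexive; Transitive)
open import Relation.Binary.PropositionalEquality using (_≡_; _≢_; refl; sym; trans; cong; subst)
open import Relation.Binary.Construct.Closure.Equivalence using (EqClosure; setoid; return)
open import Relation.Binary.Construct.Closure.ReflexiveTransitive using (ε; _◅_; _◅◅_)
open import Relation.Binary.Construct.Closure.Symmetric using (fwd; bwd)
import Relation.Binary.Reasoning.Setoid as SetoidReasoning

∣p∪q∣≤∣p∣+∣q∣ : ∀ {n} (p q : Subset n) → ∣ p ∪ q ∣ ≤ ∣ p ∣ + ∣ q ∣
∣p∪q∣≤∣p∣+∣q∣ [] [] = z≤n
∣p∪q∣≤∣p∣+∣q∣ (inside ∷ p) (inside ∷ q) =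
  s≤s (≤-trans (∣p∪q∣≤∣p∣+∣q∣ p q) (+-monoʳ-≤ ∣ p ∣ (n≤1+n ∣ q ∣)))
∣p∪q∣≤∣p∣+∣q∣ (inside ∷ p) (outside ∷ q) = s≤s (∣p∪q∣≤∣p∣+∣q∣ p q)
∣p∪q∣≤∣p∣+∣q∣ (outside ∷ p) (inside ∷ q) =
  ≤-trans (s≤s (∣p∪q∣≤∣p∣+∣q∣ p q)) (≤-reflexive (sym (+-suc ∣ p ∣ ∣ q ∣)))
∣p∪q∣≤∣p∣+∣q∣ (outside ∷ p) (outside ∷ q) = ∣p∪q∣≤∣p∣+∣q∣ p q

∣p∣<n⇒∃x∉p : ∀ {n} (p : Subset n) → ∣ p ∣ < n → ∃ λ x → x ∉ p
∣p∣<n⇒∃x∉p (outside ∷ p) _ = fzero , λ ()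
∣p∣<n⇒∃x∉p (inside ∷ p) (s≤s ∣p∣<n) with ∣p∣<n⇒∃x∉p p ∣p∣<n
... | x , x∉p = fsuc x , x∉p ∘ drop-there

x∈tabulate : ∀ {n} (f : Fin n → _) {x} → f x ≡ true → x ∈ tabulate f
x∈tabulate f {x} fx≡true = lookup⇒[]= x (tabulate f) (trans (lookup∘tabulate f x) fx≡true)

image : ∀ {m n} → (Fin m → Fin n) → Subset m → Subset n
image f [] = ⊥
image f (inside ∷ p) = ⁅ f fzero ⁆ ∪ image (f ∘ fsuc) p
image f (outside ∷ p) = image (f ∘ fsuc) p

∈-image : ∀ {m n} (f : Fin m → Fin n) {p x} → x ∈ p → f x ∈ image f p
∈-image f {inside ∷ p} here = p⊆p∪q (image (f ∘ fsuc) p) (x∈⁅x⁆ (f fzero))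
∈-image f {inside ∷ p} (there x∈p) = q⊆p∪q ⁅ f fzero ⁆ _ (∈-image (f ∘ fsuc) x∈p)
∈-image f {outside ∷ p} (there x∈p) = ∈-image (f ∘ fsuc) x∈p

∣image∣≤∣p∣ : ∀ {m n} (f : Fin m → Fin n) (p : Subset m) → ∣ image f p ∣ ≤ ∣ p ∣
∣image∣≤∣p∣ {n = n} f [] = ≤-reflexive (∣⊥∣≡0 n)
∣image∣≤∣p∣ f (inside ∷ p) = begin
  ∣ ⁅ f fzero ⁆ ∪ image (f ∘ fsuc) p ∣     ≤⟨ ∣p∪q∣≤∣p∣+∣q∣ ⁅ f fzero ⁆ _ ⟩
  ∣ ⁅ f fzero ⁆ ∣ + ∣ image (f ∘ fsuc) p ∣  ≡⟨ cong (_+ ∣ image (f ∘ fsuc) p ∣) (∣⁅x⁆∣≡1 (f fzero)) ⟩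
  suc ∣ image (f ∘ fsuc) p ∣                ≤⟨ s≤s (∣image∣≤∣p∣ (f ∘ fsuc) p) ⟩
  suc ∣ p ∣                                 ∎
  where open ≤-Reasoning
∣image∣≤∣p∣ f (outside ∷ p) = ∣image∣≤∣p∣ (f ∘ fsuc) p

establish-everywhere :
  ∀ {a ℓ p} {S : Set a} (_⇝_ : Rel S ℓ) → Reflexive _⇝_ → Transitive _⇝_ →
  ∀ {m} (P : S → Fin m → Set p) →
  (∀ s x → ∃ λ s' → s ⇝ s' × P s' x × (∀ y → P s y → P s' y)) →
  ∀ s → ∃ λ s' → s ⇝ s' × ∀ x → P s' x
establish-everywhere _⇝_ ⇝-refl ⇝-trans {zero} P establish s = s , ⇝-refl , λ ()
establish-everywhere _⇝_ ⇝-refl ⇝-trans {suc m} P establish s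
  with establish-everywhere _⇝_ ⇝-refl ⇝-trans (λ t → P t ∘ fsuc) establish-suc s
  where
  establish-suc : ∀ t x → ∃ λ t' → t ⇝ t' × P t' (fsuc x) × (∀ y → P t (fsuc y) → P t' (fsuc y))
  establish-suc t x with establish t (fsuc x)
  ... | t' , t⇝t' , Pt'x , keep = t' , t⇝t' , Pt'x , keep ∘ fsuc
... | s₁ , s⇝s₁ , P-suc with establish s₁ fzero
... | s₂ , s₁⇝s₂ , P-zero , keep = s₂ , ⇝-trans s⇝s₁ s₁⇝s₂ , P-all
  where
  P-all : ∀ x → P s₂ x
  P-all fzero = P-zero
  P-all (fsuc x) = keep (fsuc x) (P-suc x)

module _ {n : ℕ} {a b : Fin n} where

  K-adj⁺ : a ≢ b → adj (K n) a b ≡ true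
  K-adj⁺ a≢b with a ≟ b
  ... | yes a≡b = contradiction a≡b a≢b
  ... | no _ = refl

  K-adj⁻ : adj (K n) a b ≡ true → a ≢ b
  K-adj⁻ adj≡true with a ≟ b
  K-adj⁻ () | yes _
  ... | no a≢b = a≢b

module Colourings (G : Graph) (n : ℕ) where

  private
    V = Fin (size G)

  IsProper : (V → Fin n) → Set
  IsProper f = ∀ x y → adj G x y ≡ true → f x ≢ f y

  record Colouring : Set where
    field
      colour : V → Fin n
      proper : IsProper colour
  open Colouring

  _≼ₖ_ : Rel (Cell G (K n)) _
  _≼ₖ_ = _≼_ {G} {K n}

  Connected : Rel (Cell G (K n)) _
  Connected = EqClosure _≼ₖ_

  vertex : Colouring → Cell G (K n)
  vertex f = (λ x → ⁅ colour f x ⁆) , (λ x → colour f x , x∈⁅x⁆ (colour f x)) , is-cell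
    where
    is-cell : ∀ x y → adj G x y ≡ true → ∀ a b → a ∈ ⁅ colour f x ⁆ → b ∈ ⁅ colour f y ⁆ → adj (K n) a b ≡ true
    is-cell x y xy a b a∈ b∈
      rewrite x∈⁅y⁆⇒x≡y _ a∈ | x∈⁅y⁆⇒x≡y _ b∈ = K-adj⁺ (proper f x y xy)

  pick : Cell G (K n) → Colouring
  pick (_ , nonempty , is-cell) = record
    { colour = λ x → proj₁ (nonempty x)
    ; proper = λ x y xy → K-adj⁻ (is-cell x y xy _ _ (proj₂ (nonempty x)) (proj₂ (nonempty y)))
    }

  vertex-pick-≼ : ∀ σ → vertex (pick σ) ≼ₖ σ
  vertex-pick-≼ (η , nonempty , _) x a∈ =
    subst (_∈ η x) (sym (x∈⁅y⁆⇒x≡y _ a∈)) (proj₂ (nonempty x))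

  vertex-≼ : ∀ {f g} → (∀ x → colour f x ≡ colour g x) → vertex f ≼ₖ vertex g
  vertex-≼ f≗g x = subst (λ c → _ ∈ ⁅ c ⁆) (f≗g x)

  connected-via-span :
    (f f' : Colouring) → (∀ x y → adj G x y ≡ true → colour f x ≢ colour f' y) →
    Connected (vertex f) (vertex f')
  connected-via-span f f' cross = _◅_ {j = span-cell} (fwd f≼span) (bwd f'≼span ◅ ε)
    where
    span : V → Subset n
    span x = ⁅ colour f x ⁆ ∪ ⁅ colour f' x ⁆

    ∈-span : ∀ {a x} → a ∈ span x → a ≡ colour f x ⊎ a ≡ colour f' x
    ∈-span {x = x} a∈ with x∈p∪q⁻ ⁅ colour f x ⁆ _ a∈
    ... | inj₁ a∈f = inj₁ (x∈⁅y⁆⇒x≡y _ a∈f)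
    ... | inj₂ a∈f' = inj₂ (x∈⁅y⁆⇒x≡y _ a∈f')

    distinct : ∀ {x y a b} → adj G x y ≡ true →
      a ≡ colour f x ⊎ a ≡ colour f' x → b ≡ colour f y ⊎ b ≡ colour f' y → a ≢ b
    distinct xy (inj₁ refl) (inj₁ refl) = proper f _ _ xy
    distinct xy (inj₁ refl) (inj₂ refl) = cross _ _ xy
    distinct {x} {y} xy (inj₂ refl) (inj₁ refl) = cross y x (trans (adj-sym G y x) xy) ∘ sym
    distinct xy (inj₂ refl) (inj₂ refl) = proper f' _ _ xy

    span-cell : Cell G (K n)
    span-cell = span , (λ x → colour f x , p⊆p∪q _ (x∈⁅x⁆ (colour f x))) ,
      λ x y xy a b a∈ b∈ → K-adj⁺ (distinct xy (∈-span a∈) (∈-span b∈))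

    f≼span : vertex f ≼ₖ span-cell
    f≼span x = p⊆p∪q ⁅ colour f' x ⁆

    f'≼span : vertex f' ≼ₖ span-cell
    f'≼span x = q⊆p∪q ⁅ colour f x ⁆ _

  Avoids : (V → Fin n) → V → Fin n → Set
  Avoids f w c = ∀ u → adj G w u ≡ true → f u ≢ c

  recolour : (f : Colouring) (w : V) (c : Fin n) → Avoids (colour f) w c → Colouring
  recolour f w c avoids = record { colour = f' ; proper = f'-proper }
    where
    f' : V → Fin n
    f' = updateAt (colour f) w (const c)

    f'-proper : IsProper f'
    f'-proper x y xy with x ≟ w | y ≟ w
    ... | yes refl | yes refl = contradiction refl (proper f x x xy)
    ... | yes refl | no y≢w
      rewrite updateAt-updates w {const c} (colour f) | updateAt-minimal y w {const c} (colour f) y≢w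
      = avoids y xy ∘ sym
    ... | no x≢w | yes refl
      rewrite updateAt-updates w {const c} (colour f) | updateAt-minimal x w {const c} (colour f) x≢w
      = avoids x (trans (adj-sym G w x) xy)
    ... | no x≢w | no y≢w
      rewrite updateAt-minimal x w {const c} (colour f) x≢w | updateAt-minimal y w {const c} (colour f) y≢w
      = proper f x y xy

  recolour-connected : ∀ f w c avoids → Connected (vertex f) (vertex (recolour f w c avoids))
  recolour-connected f w c avoids = connected-via-span f (recolour f w c avoids) cross
    where
    cross : ∀ x y → adj G x y ≡ true → colour f x ≢ colour (recolour f w c avoids) y
    cross x y xy with y ≟ w
    ... | yes refl rewrite updateAt-updates w {const c} (colour f) = avoids x (trans (adj-sym G w x) xy)
    ... | no y≢w rewrite updateAt-minimal y w {const c} (colour f) y≢w = proper f x y xy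

  _⇝[_]_ : Colouring → Colouring → Colouring → Set
  f ⇝[ g ] f' = Connected (vertex f) (vertex f') × (∀ x → colour f x ≡ colour g x → colour f' x ≡ colour g x)

  ⇝-refl : ∀ g → Reflexive _⇝[ g ]_
  ⇝-refl g = ε , λ _ f≡g → f≡g

  ⇝-trans : ∀ g → Transitive _⇝[ g ]_
  ⇝-trans g (f~f' , keep) (f'~f'' , keep') = f~f' ◅◅ f'~f'' , λ x → keep' x ∘ keep x

  recolour-⇝ : ∀ g f w c avoids → (colour f w ≡ colour g w → c ≡ colour g w) →
    f ⇝[ g ] recolour f w c avoids
  recolour-⇝ g f w c avoids keep-w = recolour-connected f w c avoids , keep
    where
    keep : ∀ x → colour f x ≡ colour g x → colour (recolour f w c avoids) x ≡ colour g x
    keep x with x ≟ w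
    ... | yes refl rewrite updateAt-updates w {const c} (colour f) = keep-w
    ... | no x≢w rewrite updateAt-minimal x w {const c} (colour f) x≢w = λ fx≡gx → fx≡gx

  module _ {d} (valency≤d : ∀ x → valency G x ≤ d) (d+2≤n : d + 2 ≤ n) where

    fresh-colour : ∀ (f : V → Fin n) w a → ∃ λ c → c ≢ a × Avoids f w c
    fresh-colour f w a with ∣p∣<n⇒∃x∉p forbidden ∣forbidden∣<n
      where
      forbidden : Subset n
      forbidden = ⁅ a ⁆ ∪ image f (nbhd G w)

      ∣forbidden∣<n : ∣ forbidden ∣ < n
      ∣forbidden∣<n = begin-strict
        ∣ ⁅ a ⁆ ∪ image f (nbhd G w) ∣      ≤⟨ ∣p∪q∣≤∣p∣+∣q∣ ⁅ a ⁆ _ ⟩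
        ∣ ⁅ a ⁆ ∣ + ∣ image f (nbhd G w) ∣  ≡⟨ cong (_+ ∣ image f (nbhd G w) ∣) (∣⁅x⁆∣≡1 a) ⟩
        suc ∣ image f (nbhd G w) ∣          ≤⟨ s≤s (∣image∣≤∣p∣ f (nbhd G w)) ⟩
        suc (valency G w)                   ≤⟨ s≤s (valency≤d w) ⟩
        suc d                               <⟨ n<1+n (suc d) ⟩
        2 + d                               ≡⟨ +-comm 2 d ⟩
        d + 2                               ≤⟨ d+2≤n ⟩
        n                                   ∎
        where open ≤-Reasoning
    ... | c , c∉forbidden =
      c , (λ { refl → c∉forbidden (p⊆p∪q _ (x∈⁅x⁆ c)) }) ,
      λ { u wu refl → c∉forbidden (q⊆p∪q ⁅ a ⁆ _ (∈-image f (x∈tabulate (adj G w) wu))) }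

    clear-colour : ∀ g a f → ∃ λ f' → f ⇝[ g ] f' × ∀ x → colour f' x ≡ a → colour f' x ≡ colour g x
    clear-colour g a = establish-everywhere _⇝[ g ]_ (⇝-refl g) (⇝-trans g) Cleared clear-at
      where
      Cleared : Colouring → V → Set
      Cleared f x = colour f x ≡ a → colour f x ≡ colour g x

      clear-at : ∀ f w → ∃ λ f' → f ⇝[ g ] f' × Cleared f' w × (∀ x → Cleared f x → Cleared f' x)
      clear-at f w with colour f w ≟ a | colour f w ≟ colour g w
      ... | no fw≢a | _ = f , ⇝-refl g , (λ fw≡a → contradiction fw≡a fw≢a) , λ _ cleared → cleared
      ... | _ | yes fw≡gw = f , ⇝-refl g , (λ _ → fw≡gw) , λ _ cleared → cleared
      ... | yes _ | no fw≢gw with fresh-colour (colour f) w a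
      ...   | c , c≢a , avoids =
        recolour f w c avoids , recolour-⇝ g f w c avoids (λ fw≡gw → contradiction fw≡gw fw≢gw) ,
        cleared-w , cleared-x
        where
        cleared-w : Cleared (recolour f w c avoids) w
        cleared-w rewrite updateAt-updates w {const c} (colour f) = λ c≡a → contradiction c≡a c≢a

        cleared-x : ∀ x → Cleared f x → Cleared (recolour f w c avoids) x
        cleared-x x with x ≟ w
        ... | yes refl = λ _ → cleared-w
        ... | no x≢w rewrite updateAt-minimal x w {const c} (colour f) x≢w = λ cleared → cleared

    fix-vertex : ∀ g w f → ∃ λ f' → f ⇝[ g ] f' × colour f' w ≡ colour g w
    fix-vertex g w f with clear-colour g (colour g w) f
    ... | f₁ , f⇝f₁ , cleared =
      recolour f₁ w (colour g w) avoids ,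
      ⇝-trans g f⇝f₁ (recolour-⇝ g f₁ w (colour g w) avoids (λ _ → refl)) ,
      updateAt-updates w (colour f₁)
      where
      avoids : Avoids (colour f₁) w (colour g w)
      avoids u wu f₁u≡gw = proper g w u wu (sym (trans (sym (cleared u f₁u≡gw)) f₁u≡gw))

    reach : ∀ g f → ∃ λ f' → f ⇝[ g ] f' × ∀ x → colour f' x ≡ colour g x
    reach g = establish-everywhere _⇝[ g ]_ (⇝-refl g) (⇝-trans g) (λ f x → colour f x ≡ colour g x) fix-at
      where
      fix-at : ∀ f w → ∃ λ f' → f ⇝[ g ] f' × colour f' w ≡ colour g w ×
        (∀ x → colour f x ≡ colour g x → colour f' x ≡ colour g x)
      fix-at f w with fix-vertex g w f
      ... | f' , f⇝f' , f'w≡gw = f' , f⇝f' , f'w≡gw , proj₂ f⇝f'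

    colourings-connected : ∀ f g → Connected (vertex f) (vertex g)
    colourings-connected f g with reach g f
    ... | f' , (f~f' , _) , f'≗g = f~f' ◅◅ return (vertex-≼ {f'} {g} f'≗g)

proposition2p4 : (G : Graph) (d : ℕ) → MaxValency G d →
    ∀ (n : ℕ) → d + 2 ≤ n → HomConnected G (K n)
proposition2p4 G d (_ , valency≤d) n d+2≤n σ τ = begin
  σ                   ≈⟨ return (vertex-pick-≼ σ) ⟨
  vertex (pick σ)     ≈⟨ colourings-connected valency≤d d+2≤n (pick σ) (pick τ) ⟩
  vertex (pick τ)     ≈⟨ return (vertex-pick-≼ τ) ⟩
  τ                   ∎
  where
  open Colourings G n
  open SetoidReasoning (setoid _≼ₖ_)
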